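{- Let $\rho\in(0,1)$ and let $\sigma$ be any one of the Jaccard, Cosine or Dice similarity measurements. Let $(u,v)$ be an edge of an undirected graph and consider a moment at which $n_u\le n_v$ and an estimate $\tilde\sigma(u,v)$ is computed as follows: $\tilde\sigma(u,v)=0$ if $n_u\le\frac14\rho^2 n_v$, and otherwise $\tilde\sigma(u,v)$ is a $\frac12\rho$-absolute-approximation, i.e. $|\tilde\sigma(u,v)-\sigma(u,v)|\le\frac12\rho$ at that moment. Then the update affordability satisfies $\tau(u,v)\ge\frac14\rho^2 n_v\in\Omega(d_{\max}(u,v))$, where $d_{\max}(u,v)=\max\{d_u,d_v\}$ and $n_v,d_u,d_v$ are taken at that moment; that is, at every moment during any sequence of at most $\frac14\rho^2 n_v$ arbitrary affecting updates after that moment, $|\tilde\sigma(u,v)-\sigma(u,v)|\le\rho$ holds with respect to the current graph.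
   Context: For a vertex $u$ of an undirected graph, $N(u)$ is its set of neighbors, $d_u=|N(u)|$, $N[u]=N(u)\cup\{u\}$, $n_u=|N[u]|$, and $I(u,v)=|N[u]\cap N[v]|$. For an edge $(u,v)$: Jaccard $\sigma(u,v)=\frac{I(u,v)}{n_u+n_v-I(u,v)}$, Cosine $\sigma(u,v)=\frac{I(u,v)}{\sqrt{n_un_v}}$, Dice $\sigma(u,v)=\frac{I(u,v)}{(n_u+n_v)/2}$. An affecting update of the edge $(u,v)$ is an insertion or deletion of an edge (other than $(u,v)$) incident on $u$ or on $v$; such updates change $n_u$ or $n_v$ and possibly $I(u,v)$. The update affordability $\tau(u,v)$ of $(u,v)$, relative to the moment when the estimate $\tilde\sigma(u,v)$ is computed, is a lower bound on the number of affecting updates such that $\tilde\sigma(u,v)$ remains a valid $\rho$-absolute approximation ($|\tilde\sigma(u,v)-\sigma(u,v)|\le\rho$) at any moment within that many affecting updates.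
   Formalization: The parameter ρ and the estimate $\tilde\sigma(u,v)$ take values in ℚ. -}

module Defs where

open import Data.Bool using (Bool; true; false; not)
open import Data.Nat as ℕ using (ℕ; zero; suc; _∸_; _⊔_)
open import Data.Integer using (+_)
open import Data.Rational using (ℚ; _/_; 0ℚ; _-_; _+_; _*_; _≤_; ∣_∣)
open import Data.Fin using (Fin)
open import Data.Fin.Subset using (Subset; _∩_; _∪_; ⁅_⁆) renaming (∣_∣ to card)
open import Data.Vec using (tabulate)
open import Data.Product using (_×_; Σ; ∃; _,_)
open import Data.Sum using (_⊎_)
open import Relation.Binary.PropositionalEquality using (_≡_; _≢_)
open import Relation.Nullary using (¬_)

record Graph (V : ℕ) : Set where
  field
    adj   : Fin V → Fin V → Bool
    sym   : ∀ a b → adj a b ≡ adj b a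
    irrefl : ∀ a → adj a a ≡ false
open Graph public

N : ∀ {V} → Graph V → Fin V → Subset V
N G u = tabulate (adj G u)

N[_] : ∀ {V} → Graph V → Fin V → Subset V
N[ G ] u = N G u ∪ ⁅ u ⁆

deg : ∀ {V} → Graph V → Fin V → ℕ
deg G u = card (N G u)

nn : ∀ {V} → Graph V → Fin V → ℕ
nn G u = card (N[ G ] u)

II : ∀ {V} → Graph V → Fin V → Fin V → ℕ
II G u v = card (N[ G ] u ∩ N[ G ] v)

ι : ℕ → ℚ
ι n = + n / 1

-- a / b as a rational (b = 0 never occurs for the quantities below, since n_u ≥ 1)
frac : ℕ → ℕ → ℚ
frac a zero    = 0ℚ
frac a (suc b) = + a / suc b

data Measure : Set where
  jaccard cosine dice : Measure

-- |s - x| ≤ ρ where x = I / sqrt P (P = n_u n_v ≥ 1), written without square roots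
-- (ℚ has no square roots):  s - ρ ≤ I/√P  and  I/√P ≤ s + ρ, with I ≥ 0, P > 0.
CosApprox : (s ρ : ℚ) (I P : ℕ) → Set
CosApprox s ρ I P =
  ((s - ρ ≤ 0ℚ) ⊎ ((s - ρ) * (s - ρ) * ι P ≤ ι (I ℕ.* I)))
  × ((0ℚ ≤ s + ρ) × (ι (I ℕ.* I) ≤ (s + ρ) * (s + ρ) * ι P))

Approx : ∀ {V} → Measure → Graph V → Fin V → Fin V → (s ρ : ℚ) → Set
Approx jaccard G u v s ρ =
  ∣ s - frac (II G u v) (nn G u ℕ.+ nn G v ∸ II G u v) ∣ ≤ ρ
Approx cosine  G u v s ρ = CosApprox s ρ (II G u v) (nn G u ℕ.* nn G v)
Approx dice    G u v s ρ =
  ∣ s - frac (2 ℕ.* II G u v) (nn G u ℕ.+ nn G v) ∣ ≤ ρ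

SameEdge : ∀ {V} → Fin V → Fin V → Fin V → Fin V → Set
SameEdge a b x y = (a ≡ x × b ≡ y) ⊎ (a ≡ y × b ≡ x)

-- G' is obtained from G by inserting (if absent) or deleting (if present)
-- the edge {x,y}: the adjacency of {x,y} is flipped, all else unchanged.
Toggle : ∀ {V} → Graph V → Fin V → Fin V → Graph V → Set
Toggle G x y G' =
  ∀ a b → (SameEdge a b x y → adj G' a b ≡ not (adj G a b))
        × (¬ SameEdge a b x y → adj G' a b ≡ adj G a b)

AffectingUpdate : ∀ {V} → Fin V → Fin V → Graph V → Graph V → Set
AffectingUpdate u v G G' =
  Σ _ λ x → Σ _ λ y →
    x ≢ y × ¬ SameEdge x y u v
    × ((x ≡ u ⊎ x ≡ v) ⊎ (y ≡ u ⊎ y ≡ v))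
    × Toggle G x y G'

data Updates {V} (u v : Fin V) : Graph V → ℕ → Graph V → Set where
  done : ∀ {G} → Updates u v G 0 G
  step : ∀ {G G' G'' k} → AffectingUpdate u v G G' → Updates u v G' k G''
       → Updates u v G (suc k) G''

-- Write a, b, I, T for n_u, n_v, I(u,v), |N[u] ∪ N[v]| when the estimate is computed, and a′, b′, I′, T′
-- for the same counts after k affecting updates. Each affecting update toggles exactly one entry of the
-- pair of rows (N[u], N[v]), and each changed entry moves every count by at most one; this gives linear
-- drift inequalities such as I′ + a ≤ I + a′ + k, each checked on the sixteen before/after states of an entry.
-- Put r = ρ/2, so that k ≤ r²b. If a ≤ r²b the estimate is 0, and N[u] stays so small compared with
-- N[v] that every measure stays below 2r = ρ. Otherwise a > r²b makes k small against every
-- denominator, so each measure moves by at most r, and the r-accurate estimate stays within 2r of the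
-- new value. For the cosine, where ℚ has no square roots, all comparisons are made between squares.
module Submission where

open import Defs hiding (sym)
open import Data.Bool using (Bool; true; false; _∧_; _∨_; _xor_)
open import Data.Bool.Properties using (xor-same)
open import Data.Nat as ℕ using (ℕ; _⊔_)
import Data.Nat.Properties as ℕₚ
open import Data.Integer as ℤ using (+_)
import Data.Integer.Properties as ℤₚ
open import Data.Fin using (Fin)
open import Data.Fin.Subset using (Subset; _∩_; _∪_; ⁅_⁆) renaming (∣_∣ to card)
open import Data.Fin.Subset.Properties
  using (∣p∩q∣≤∣p∣; ∣p∩q∣≤∣q∣; ∣q∣≤∣p∪q∣; ∣⁅x⁆∣≡1; x∈⁅x⁆; x∈p∪q⁺; x∈p⇒∣p-x∣<∣p∣; p⊆q⇒∣p∣≤∣q∣; p⊆p∪q)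
open import Data.Vec using ([]; _∷_; lookup; zipWith)
open import Data.Vec.Properties using (lookup-zipWith; lookup∘tabulate; []=⇒lookup)
open import Data.Product using (∃-syntax; _×_; _,_; proj₁; proj₂)
open import Data.Sum using (_⊎_; inj₁; inj₂)
open import Data.Empty using (⊥-elim)
open import Function using (_∘_; id)
open import Relation.Nullary using (¬_; Dec; yes; no)
open import Relation.Nullary.Decidable using (True; toWitness)
open import Relation.Binary.PropositionalEquality hiding ([_])

-- A separate module, so that _+_ and _≤_ are those of ℕ here and those of ℚ afterwards.
module Combinatorial where

  open import Data.Nat using (zero; suc; _+_; _≤_; _≤?_; z≤n; s≤s)
  open import Data.Fin using (zero; suc; _≟_)
  open import Algebra.Properties.CommutativeMonoid.Sum ℕₚ.+-0-commutativeMonoid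
    using (sum; ∑-distrib-+; sum-cong-≗; sum-replicate-zero)
  open import Algebra.Properties.CommutativeSemigroup ℕₚ.+-commutativeSemigroup using (interchange)

  record Counts : Set where
    field
      a b I T : ℕ
      I≤a     : I ≤ a
      I≤b     : I ≤ b
      b≤T     : b ≤ T
      a+b≡I+T : a + b ≡ I + T
      1≤a     : 1 ≤ a
      1≤b     : 1 ≤ b

  module _ (C C′ : Counts) where
    open Counts C
    open Counts C′ using () renaming (a to a′; b to b′; I to I′; T to T′)

    -- The mixed inequalities such as I′ + a ≤ I + a′ + k bound the change of |N[u] ∖ N[v]| = a − I and
    -- of |N[v] ∖ N[u]| = b − I, which the cosine needs.
    record Drift (k : ℕ) : Set where
      field
        a′≤a+k      : a′ ≤ a + k
        b≤b′+k      : b ≤ b′ + k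
        a′+b≤a+b′+k : a′ + b ≤ a + b′ + k
        a+b≤a′+b′+k : a + b ≤ a′ + b′ + k
        I′≤I+k      : I′ ≤ I + k
        I≤I′+k      : I ≤ I′ + k
        I′+a≤I+a′+k : I′ + a ≤ I + a′ + k
        I′+b≤I+b′+k : I′ + b ≤ I + b′ + k
        I+a′≤a+I′+k : I + a′ ≤ a + I′ + k
        I+b′≤b+I′+k : I + b′ ≤ b + I′ + k
        T′+I≤T+I′+k : T′ + I ≤ T + I′ + k
        T+I≤T′+I′+k : T + I ≤ T′ + I′ + k
        I′+T≤I+T′+k : I′ + T ≤ I + T′ + k
        I′+T′≤I+T+k : I′ + T′ ≤ I + T + k

  ⟦_⟧ : Bool → ℕ
  ⟦ true ⟧  = 1
  ⟦ false ⟧ = 0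

  ⟦⟧≤1 : ∀ x → ⟦ x ⟧ ≤ 1
  ⟦⟧≤1 true  = s≤s z≤n
  ⟦⟧≤1 false = z≤n

  ∑-mono-≤ : ∀ {n} {f g : Fin n → ℕ} → (∀ i → f i ≤ g i) → sum f ≤ sum g
  ∑-mono-≤ {zero}  f≤g = z≤n
  ∑-mono-≤ {suc n} f≤g = ℕₚ.+-mono-≤ (f≤g zero) (∑-mono-≤ (f≤g ∘ suc))

  card≡∑ : ∀ {n} (p : Subset n) → card p ≡ sum (λ i → ⟦ lookup p i ⟧)
  card≡∑ []          = refl
  card≡∑ (true ∷ p)  = cong suc (card≡∑ p)
  card≡∑ (false ∷ p) = card≡∑ p

  card-zipWith≡∑ : ∀ {n} (f : Bool → Bool → Bool) (p q : Subset n) →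
                   card (zipWith f p q) ≡ sum (λ i → ⟦ f (lookup p i) (lookup q i) ⟧)
  card-zipWith≡∑ f p q =
    trans (card≡∑ (zipWith f p q)) (sum-cong-≗ (λ i → cong ⟦_⟧ (lookup-zipWith f i p q)))

  ∣p∣+∣q∣≡∣p∩q∣+∣p∪q∣ : ∀ {n} (p q : Subset n) → card p + card q ≡ card (p ∩ q) + card (p ∪ q)
  ∣p∣+∣q∣≡∣p∩q∣+∣p∪q∣ p q = begin
    card p + card q                  ≡⟨ cong₂ _+_ (card≡∑ p) (card≡∑ q) ⟩
    sum ⟦p⟧ + sum ⟦q⟧                ≡⟨ ∑-distrib-+ ⟦p⟧ ⟦q⟧ ⟨
    sum (λ i → ⟦p⟧ i + ⟦q⟧ i)        ≡⟨ sum-cong-≗ (λ i → modular (lookup p i) (lookup q i)) ⟩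
    sum (λ i → ⟦p∩q⟧ i + ⟦p∪q⟧ i)    ≡⟨ ∑-distrib-+ ⟦p∩q⟧ ⟦p∪q⟧ ⟩
    sum ⟦p∩q⟧ + sum ⟦p∪q⟧            ≡⟨ cong₂ _+_ (card-zipWith≡∑ _∧_ p q) (card-zipWith≡∑ _∨_ p q) ⟨
    card (p ∩ q) + card (p ∪ q)      ∎
    where
    open ≡-Reasoning
    ⟦p⟧ ⟦q⟧ ⟦p∩q⟧ ⟦p∪q⟧ : Fin _ → ℕ
    ⟦p⟧ i   = ⟦ lookup p i ⟧
    ⟦q⟧ i   = ⟦ lookup q i ⟧
    ⟦p∩q⟧ i = ⟦ lookup p i ∧ lookup q i ⟧
    ⟦p∪q⟧ i = ⟦ lookup p i ∨ lookup q i ⟧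
    modular : ∀ x y → ⟦ x ⟧ + ⟦ y ⟧ ≡ ⟦ x ∧ y ⟧ + ⟦ x ∨ y ⟧
    modular true  true  = refl
    modular true  false = refl
    modular false true  = refl
    modular false false = refl

  counts : ∀ {n} (p q : Subset n) → 1 ≤ card p → 1 ≤ card q → Counts
  counts p q 1≤p 1≤q = record
    { a = card p ; b = card q ; I = card (p ∩ q) ; T = card (p ∪ q)
    ; I≤a = ∣p∩q∣≤∣p∣ p q ; I≤b = ∣p∩q∣≤∣q∣ p q ; b≤T = ∣q∣≤∣p∪q∣ p q
    ; a+b≡I+T = ∣p∣+∣q∣≡∣p∩q∣+∣p∪q∣ p q ; 1≤a = 1≤p ; 1≤b = 1≤q
    }

  dist : ∀ {n} → Subset n → Subset n → ℕ
  dist p q = sum (λ i → ⟦ lookup p i xor lookup q i ⟧)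

  dist-triangle : ∀ {n} (p q r : Subset n) → dist p r ≤ dist p q + dist q r
  dist-triangle p q r = ℕₚ.≤-trans (∑-mono-≤ λ i → xor-triangle (lookup p i) (lookup q i) (lookup r i))
    (ℕₚ.≤-reflexive (∑-distrib-+ (λ i → ⟦ lookup p i xor lookup q i ⟧) (λ i → ⟦ lookup q i xor lookup r i ⟧)))
    where
    xor-triangle : ∀ x y z → ⟦ x xor z ⟧ ≤ ⟦ x xor y ⟧ + ⟦ y xor z ⟧
    xor-triangle true  true  true  = z≤n
    xor-triangle true  true  false = s≤s z≤n
    xor-triangle true  false true  = z≤n
    xor-triangle true  false false = s≤s z≤n
    xor-triangle false true  true  = s≤s z≤n
    xor-triangle false true  false = z≤n
    xor-triangle false false true  = s≤s z≤n
    xor-triangle false false false = z≤n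

  dist-≡-0 : ∀ {n} (p q : Subset n) → (∀ i → lookup p i ≡ lookup q i) → dist p q ≡ 0
  dist-≡-0 {n} p q p≗q = begin
    dist p q                                     ≡⟨ sum-cong-≗ (λ i → cong (λ x → ⟦ x xor lookup q i ⟧) (p≗q i)) ⟩
    sum (λ i → ⟦ lookup q i xor lookup q i ⟧)    ≡⟨ sum-cong-≗ (λ i → cong ⟦_⟧ (xor-same (lookup q i))) ⟩
    sum (λ (_ : Fin n) → 0)                      ≡⟨ sum-replicate-zero n ⟩
    0                                            ∎
    where open ≡-Reasoning

  dist-≤-1 : ∀ {n} (p q : Subset n) w → (∀ i → i ≢ w → lookup p i ≡ lookup q i) → dist p q ≤ 1
  dist-≤-1 p q w agree = begin
    dist p q                          ≤⟨ ∑-mono-≤ below-⁅w⁆ ⟩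
    sum (λ i → ⟦ lookup ⁅ w ⁆ i ⟧)    ≡⟨ card≡∑ ⁅ w ⁆ ⟨
    card ⁅ w ⁆                        ≡⟨ ∣⁅x⁆∣≡1 w ⟩
    1                                 ∎
    where
    open ℕₚ.≤-Reasoning
    below-⁅w⁆ : ∀ i → ⟦ lookup p i xor lookup q i ⟧ ≤ ⟦ lookup ⁅ w ⁆ i ⟧
    below-⁅w⁆ i with i ≟ w
    ... | yes refl rewrite []=⇒lookup (x∈⁅x⁆ w) = ⟦⟧≤1 _
    ... | no i≢w   rewrite agree i i≢w | xor-same (lookup q i) = z≤n

  all-Bool? : {P : Bool → Set} → (∀ x → Dec (P x)) → Dec (∀ x → P x)
  all-Bool? P? with P? true | P? false
  ... | yes pt | yes pf = yes λ { true → pt ; false → pf }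
  ... | no ¬pt | _      = no λ all → ¬pt (all true)
  ... | yes _  | no ¬pf = no λ all → ¬pf (all false)

  -- Entry i of the rows p, q (before) and p′, q′ (after) is a cell (x, y, x′, y′) ∈ Bool⁴. An inequality
  -- between counts holds once it holds in every cell with the cost 'flips' of the cell added, and
  -- 'cellBound?' checks that on all sixteen cells.
  module Cells {n} (p q p′ q′ : Subset n) where

    Statistic : Set
    Statistic = Bool → Bool → Bool → Bool → ℕ

    count : Statistic → ℕ
    count φ = sum (λ i → φ (lookup p i) (lookup q i) (lookup p′ i) (lookup q′ i))

    _⊞_ : Statistic → Statistic → Statistic
    (φ ⊞ ψ) x y x′ y′ = φ x y x′ y′ + ψ x y x′ y′

    count-⊞ : ∀ φ ψ → count (φ ⊞ ψ) ≡ count φ + count ψ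
    count-⊞ φ ψ = ∑-distrib-+ (λ i → φ (lookup p i) (lookup q i) (lookup p′ i) (lookup q′ i))
                              (λ i → ψ (lookup p i) (lookup q i) (lookup p′ i) (lookup q′ i))

    flips : Statistic
    flips x y x′ y′ = ⟦ x xor x′ ⟧ + ⟦ y xor y′ ⟧

    moved : ℕ
    moved = dist p p′ + dist q q′

    CellBound : Statistic → Statistic → Set
    CellBound φ ψ = ∀ x y x′ y′ → φ x y x′ y′ ≤ ψ x y x′ y′ + flips x y x′ y′

    cellBound? : ∀ φ ψ → Dec (CellBound φ ψ)
    cellBound? φ ψ = all-Bool? λ x → all-Bool? λ y → all-Bool? λ x′ → all-Bool? λ y′ →
      φ x y x′ y′ ≤? ψ x y x′ y′ + flips x y x′ y′

    count-≤ : ∀ φ ψ → CellBound φ ψ → count φ ≤ count ψ + moved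
    count-≤ φ ψ bound = begin
      count φ                  ≤⟨ ∑-mono-≤ (λ i → bound (lookup p i) (lookup q i) (lookup p′ i) (lookup q′ i)) ⟩
      count (ψ ⊞ flips)        ≡⟨ count-⊞ ψ flips ⟩
      count ψ + count flips    ≡⟨ cong (λ x → count ψ + x) (count-⊞ (λ x _ x′ _ → ⟦ x xor x′ ⟧) (λ _ y _ y′ → ⟦ y xor y′ ⟧)) ⟩
      count ψ + moved          ∎
      where open ℕₚ.≤-Reasoning

    record Quantity : Set where
      field
        value       : ℕ
        statistic   : Statistic
        count≡value : count statistic ≡ value
    open Quantity

    shift₁ : ∀ (m l : Quantity) → {True (cellBound? (statistic m) (statistic l))} →
             value m ≤ value l + moved
    shift₁ m l {bound} = subst₂ (λ x y → x ≤ y + moved) (count≡value m) (count≡value l)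
      (count-≤ (statistic m) (statistic l) (toWitness bound))

    shift₂ : ∀ (m₁ m₂ l₁ l₂ : Quantity) →
             {True (cellBound? (statistic m₁ ⊞ statistic m₂) (statistic l₁ ⊞ statistic l₂))} →
             value m₁ + value m₂ ≤ value l₁ + value l₂ + moved
    shift₂ m₁ m₂ l₁ l₂ {bound} = subst₂ (λ x y → x ≤ y + moved)
      (trans (count-⊞ (statistic m₁) (statistic m₂)) (cong₂ _+_ (count≡value m₁) (count≡value m₂)))
      (trans (count-⊞ (statistic l₁) (statistic l₂)) (cong₂ _+_ (count≡value l₁) (count≡value l₂)))
      (count-≤ (statistic m₁ ⊞ statistic m₂) (statistic l₁ ⊞ statistic l₂) (toWitness bound))

    a b I T a′ b′ I′ T′ : Quantity
    a  = record { value = card p        ; statistic = λ x _ _ _ → ⟦ x ⟧           ; count≡value = sym (card≡∑ p) }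
    b  = record { value = card q        ; statistic = λ _ y _ _ → ⟦ y ⟧           ; count≡value = sym (card≡∑ q) }
    I  = record { value = card (p ∩ q)  ; statistic = λ x y _ _ → ⟦ x ∧ y ⟧       ; count≡value = sym (card-zipWith≡∑ _∧_ p q) }
    T  = record { value = card (p ∪ q)  ; statistic = λ x y _ _ → ⟦ x ∨ y ⟧       ; count≡value = sym (card-zipWith≡∑ _∨_ p q) }
    a′ = record { value = card p′       ; statistic = λ _ _ x′ _ → ⟦ x′ ⟧         ; count≡value = sym (card≡∑ p′) }
    b′ = record { value = card q′       ; statistic = λ _ _ _ y′ → ⟦ y′ ⟧         ; count≡value = sym (card≡∑ q′) }
    I′ = record { value = card (p′ ∩ q′) ; statistic = λ _ _ x′ y′ → ⟦ x′ ∧ y′ ⟧  ; count≡value = sym (card-zipWith≡∑ _∧_ p′ q′) }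
    T′ = record { value = card (p′ ∪ q′) ; statistic = λ _ _ x′ y′ → ⟦ x′ ∨ y′ ⟧  ; count≡value = sym (card-zipWith≡∑ _∨_ p′ q′) }

    drift : ∀ {k 1≤p 1≤q 1≤p′ 1≤q′} → moved ≤ k → Drift (counts p q 1≤p 1≤q) (counts p′ q′ 1≤p′ 1≤q′) k
    drift {k} moved≤k = record
      { a′≤a+k      = within (shift₁ a′ a)
      ; b≤b′+k      = within (shift₁ b b′)
      ; a′+b≤a+b′+k = within (shift₂ a′ b a b′)
      ; a+b≤a′+b′+k = within (shift₂ a b a′ b′)
      ; I′≤I+k      = within (shift₁ I′ I)
      ; I≤I′+k      = within (shift₁ I I′)
      ; I′+a≤I+a′+k = within (shift₂ I′ a I a′)
      ; I′+b≤I+b′+k = within (shift₂ I′ b I b′)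
      ; I+a′≤a+I′+k = within (shift₂ I a′ a I′)
      ; I+b′≤b+I′+k = within (shift₂ I b′ b I′)
      ; T′+I≤T+I′+k = within (shift₂ T′ I T I′)
      ; T+I≤T′+I′+k = within (shift₂ T I T′ I′)
      ; I′+T≤I+T′+k = within (shift₂ I′ T I T′)
      ; I′+T′≤I+T+k = within (shift₂ I′ T′ I T)
      }
      where
      within : ∀ {m l} → m ≤ l + moved → m ≤ l + k
      within {l = l} m≤l+moved = ℕₚ.≤-trans m≤l+moved (ℕₚ.+-monoʳ-≤ l moved≤k)

  module _ {V} (G : Graph V) where

    N[]-lookup : ∀ z i → lookup (N[ G ] z) i ≡ adj G z i ∨ lookup ⁅ z ⁆ i
    N[]-lookup z i = trans (lookup-zipWith _∨_ i (N G z) ⁅ z ⁆) (cong (_∨ lookup ⁅ z ⁆ i) (lookup∘tabulate (adj G z) i))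

    1≤nn : ∀ z → 1 ≤ nn G z
    1≤nn z = ℕₚ.≤-trans (s≤s z≤n) (x∈p⇒∣p-x∣<∣p∣ {p = N[ G ] z} (x∈p∪q⁺ {p = N G z} (inj₂ (x∈⁅x⁆ z))))

    deg≤nn : ∀ z → deg G z ≤ nn G z
    deg≤nn z = p⊆q⇒∣p∣≤∣q∣ (p⊆p∪q {p = N G z} ⁅ z ⁆)

  module _ {V} {G G′ : Graph V} {z w : Fin V} (toggle : Toggle G z w G′) where

    toggle-lookup : ∀ x i → ¬ SameEdge x i z w → lookup (N[ G ] x) i ≡ lookup (N[ G′ ] x) i
    toggle-lookup x i ¬xi≈zw = begin
      lookup (N[ G ] x) i          ≡⟨ N[]-lookup G x i ⟩
      adj G x i ∨ lookup ⁅ x ⁆ i   ≡⟨ cong (_∨ lookup ⁅ x ⁆ i) (proj₂ (toggle x i) ¬xi≈zw) ⟨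
      adj G′ x i ∨ lookup ⁅ x ⁆ i  ≡⟨ N[]-lookup G′ x i ⟨
      lookup (N[ G′ ] x) i         ∎
      where open ≡-Reasoning

    toggle-dist-endpoint : w ≢ z → dist (N[ G ] z) (N[ G′ ] z) ≤ 1
    toggle-dist-endpoint w≢z = dist-≤-1 (N[ G ] z) (N[ G′ ] z) w λ i i≢w → toggle-lookup z i λ
      { (inj₁ (_ , i≡w)) → i≢w i≡w
      ; (inj₂ (z≡w , _)) → w≢z (sym z≡w) }

    toggle-dist-other : ∀ {x} → x ≢ z → x ≢ w → dist (N[ G ] x) (N[ G′ ] x) ≡ 0
    toggle-dist-other {x} x≢z x≢w = dist-≡-0 (N[ G ] x) (N[ G′ ] x) λ i → toggle-lookup x i λ
      { (inj₁ (x≡z , _)) → x≢z x≡z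
      ; (inj₂ (x≡w , _)) → x≢w x≡w }

  toggle-sym : ∀ {V} {G G′ : Graph V} {x y} → Toggle G x y G′ → Toggle G y x G′
  toggle-sym toggle a b = (λ ab≈yx → proj₁ (toggle a b) (swap ab≈yx))
                        , (λ ¬ab≈yx → proj₂ (toggle a b) (¬ab≈yx ∘ swap))
    where
    swap : ∀ {a b c d} → SameEdge a b c d → SameEdge a b d c
    swap (inj₁ e) = inj₂ e
    swap (inj₂ e) = inj₁ e

  affecting⇒toggle : ∀ {V} {u v : Fin V} {G G′ : Graph V} → AffectingUpdate u v G G′ →
                     ∃[ w ] (w ≢ u × w ≢ v) × (Toggle G u w G′ ⊎ Toggle G v w G′)
  affecting⇒toggle {G = G} {G′} (x , y , x≢y , ¬xy≈uv , inj₁ (inj₁ refl) , toggle) =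
    y , (x≢y ∘ sym , λ { refl → ¬xy≈uv (inj₁ (refl , refl)) }) , inj₁ toggle
  affecting⇒toggle {G = G} {G′} (x , y , x≢y , ¬xy≈uv , inj₁ (inj₂ refl) , toggle) =
    y , ((λ { refl → ¬xy≈uv (inj₂ (refl , refl)) }) , x≢y ∘ sym) , inj₂ toggle
  affecting⇒toggle {G = G} {G′} (x , y , x≢y , ¬xy≈uv , inj₂ (inj₁ refl) , toggle) =
    x , (x≢y , λ { refl → ¬xy≈uv (inj₂ (refl , refl)) }) , inj₁ (toggle-sym {G = G} {G′} {x} {y} toggle)
  affecting⇒toggle {G = G} {G′} (x , y , x≢y , ¬xy≈uv , inj₂ (inj₂ refl) , toggle) =
    x , ((λ { refl → ¬xy≈uv (inj₁ (refl , refl)) }) , x≢y) , inj₂ (toggle-sym {G = G} {G′} {x} {y} toggle)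

  module _ {V} {u v : Fin V} (u≢v : u ≢ v) where

    moved : Graph V → Graph V → ℕ
    moved G G′ = dist (N[ G ] u) (N[ G′ ] u) + dist (N[ G ] v) (N[ G′ ] v)

    moved-step : ∀ {G G′} → AffectingUpdate u v G G′ → moved G G′ ≤ 1
    moved-step {G} {G′} upd with affecting⇒toggle {u = u} {v} {G} {G′} upd
    ... | w , (w≢u , w≢v) , inj₁ toggle = ℕₚ.+-mono-≤
            (toggle-dist-endpoint {G = G} {G′} toggle w≢u)
            (ℕₚ.≤-reflexive (toggle-dist-other {G = G} {G′} toggle (u≢v ∘ sym) (w≢v ∘ sym)))
    ... | w , (w≢u , w≢v) , inj₂ toggle = ℕₚ.+-mono-≤
            (ℕₚ.≤-reflexive (toggle-dist-other {G = G} {G′} toggle u≢v (w≢u ∘ sym)))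
            (toggle-dist-endpoint {G = G} {G′} toggle w≢v)

    moved-updates : ∀ {G G′ k} → Updates u v G k G′ → moved G G′ ≤ k
    moved-updates {G} done =
      ℕₚ.≤-reflexive (cong₂ _+_ (dist-≡-0 (N[ G ] u) (N[ G ] u) (λ _ → refl)) (dist-≡-0 (N[ G ] v) (N[ G ] v) (λ _ → refl)))
    moved-updates {G} {G″} {suc k} (step {G' = G′} upd rest) = begin
      dist p p″ + dist q q″                                 ≤⟨ ℕₚ.+-mono-≤ (dist-triangle p p′ p″) (dist-triangle q q′ q″) ⟩
      (dist p p′ + dist p′ p″) + (dist q q′ + dist q′ q″)   ≡⟨ interchange (dist p p′) (dist p′ p″) (dist q q′) (dist q′ q″) ⟩
      moved G G′ + moved G′ G″                              ≤⟨ ℕₚ.+-mono-≤ (moved-step {G} {G′} upd) (moved-updates {G′} {G″} rest) ⟩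
      suc k                                                 ∎
      where
      open ℕₚ.≤-Reasoning
      p p′ p″ q q′ q″ : Subset V
      p = N[ G ] u ; p′ = N[ G′ ] u ; p″ = N[ G″ ] u
      q = N[ G ] v ; q′ = N[ G′ ] v ; q″ = N[ G″ ] v

  graph-counts : ∀ {V} → Graph V → Fin V → Fin V → Counts
  graph-counts H u v = counts (N[ H ] u) (N[ H ] v) (1≤nn H u) (1≤nn H v)

  drift-of-updates : ∀ {V} {G G′ : Graph V} {u v k} → u ≢ v → Updates u v G k G′ →
                     Drift (graph-counts G u v) (graph-counts G′ u v) k
  drift-of-updates {G = G} {G′} {u} {v} u≢v updates =
    Cells.drift (N[ G ] u) (N[ G ] v) (N[ G′ ] u) (N[ G′ ] v) (moved-updates u≢v updates)

open Combinatorial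

open import Data.Rational hiding (_⊔_)
open import Data.Rational.Properties
import Data.Rational.Unnormalised as ℚᵘ
import Data.Rational.Unnormalised.Properties as ℚᵘₚ
open import Data.Rational.Solver using (module +-*-Solver)
open +-*-Solver

ι≃mkℚᵘ : ∀ n → toℚᵘ (ι n) ℚᵘ.≃ ℚᵘ.mkℚᵘ (+ n) 0
ι≃mkℚᵘ n = toℚᵘ-fromℚᵘ (ℚᵘ.mkℚᵘ (+ n) 0)

ι-+ : ∀ m n → ι (m ℕ.+ n) ≡ ι m + ι n
ι-+ m n = toℚᵘ-injective (begin-equality
  toℚᵘ (ι (m ℕ.+ n))                       ≃⟨ ι≃mkℚᵘ (m ℕ.+ n) ⟩
  ℚᵘ.mkℚᵘ (+ (m ℕ.+ n)) 0                  ≃⟨ ℚᵘ.*≡* (cong (ℤ._* + 1)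
                                                (sym (cong₂ ℤ._+_ (ℤₚ.*-identityʳ (+ m)) (ℤₚ.*-identityʳ (+ n))))) ⟩
  ℚᵘ.mkℚᵘ (+ m) 0 ℚᵘ.+ ℚᵘ.mkℚᵘ (+ n) 0      ≃⟨ ℚᵘₚ.+-cong (ι≃mkℚᵘ m) (ι≃mkℚᵘ n) ⟨
  toℚᵘ (ι m) ℚᵘ.+ toℚᵘ (ι n)                ≃⟨ toℚᵘ-homo-+ (ι m) (ι n) ⟨
  toℚᵘ (ι m + ι n)                         ∎)
  where open ℚᵘₚ.≤-Reasoning

ι-* : ∀ m n → ι (m ℕ.* n) ≡ ι m * ι n
ι-* m n = toℚᵘ-injective (begin-equality
  toℚᵘ (ι (m ℕ.* n))                       ≃⟨ ι≃mkℚᵘ (m ℕ.* n) ⟩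
  ℚᵘ.mkℚᵘ (+ (m ℕ.* n)) 0                  ≃⟨ ℚᵘ.*≡* (cong (ℤ._* + 1) (ℤₚ.pos-* m n)) ⟩
  ℚᵘ.mkℚᵘ (+ m) 0 ℚᵘ.* ℚᵘ.mkℚᵘ (+ n) 0      ≃⟨ ℚᵘₚ.*-cong (ι≃mkℚᵘ m) (ι≃mkℚᵘ n) ⟨
  toℚᵘ (ι m) ℚᵘ.* toℚᵘ (ι n)                ≃⟨ toℚᵘ-homo-* (ι m) (ι n) ⟨
  toℚᵘ (ι m * ι n)                         ∎)
  where open ℚᵘₚ.≤-Reasoning

ι-mono-≤ : ∀ {m n} → m ℕ.≤ n → ι m ≤ ι n
ι-mono-≤ {m} {n} m≤n = toℚᵘ-cancel-≤ (begin
  toℚᵘ (ι m)         ≃⟨ ι≃mkℚᵘ m ⟩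
  ℚᵘ.mkℚᵘ (+ m) 0    ≤⟨ ℚᵘ.*≤* (ℤₚ.*-monoʳ-≤-nonNeg (+ 1) (ℤ.+≤+ m≤n)) ⟩
  ℚᵘ.mkℚᵘ (+ n) 0    ≃⟨ ι≃mkℚᵘ n ⟨
  toℚᵘ (ι n)         ∎)
  where open ℚᵘₚ.≤-Reasoning

0≤ι : ∀ n → 0ℚ ≤ ι n
0≤ι n = ι-mono-≤ (ℕ.z≤n {n})

0<ι : ∀ {n} → 1 ℕ.≤ n → 0ℚ < ι n
0<ι 1≤n = <-≤-trans (*<* (ℤ.+<+ (ℕ.s≤s ℕ.z≤n))) (ι-mono-≤ 1≤n)

frac-*-ι : ∀ p {D} → 1 ℕ.≤ D → frac p D * ι D ≡ ι p
frac-*-ι p {ℕ.suc n} _ = toℚᵘ-injective (begin-equality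
  toℚᵘ (frac p (ℕ.suc n) * ι (ℕ.suc n))               ≃⟨ toℚᵘ-homo-* (frac p (ℕ.suc n)) (ι (ℕ.suc n)) ⟩
  toℚᵘ (frac p (ℕ.suc n)) ℚᵘ.* toℚᵘ (ι (ℕ.suc n))      ≃⟨ ℚᵘₚ.*-cong (toℚᵘ-fromℚᵘ (ℚᵘ.mkℚᵘ (+ p) n)) (ι≃mkℚᵘ (ℕ.suc n)) ⟩
  ℚᵘ.mkℚᵘ (+ p) n ℚᵘ.* ℚᵘ.mkℚᵘ (+ ℕ.suc n) 0           ≃⟨ ℚᵘ.*≡* (ℤₚ.*-assoc (+ p) (+ ℕ.suc n) (+ 1)) ⟩
  ℚᵘ.mkℚᵘ (+ p) 0                                     ≃⟨ ι≃mkℚᵘ p ⟨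
  toℚᵘ (ι p)                                          ∎)
  where open ℚᵘₚ.≤-Reasoning

ι-≤-+ : ∀ {m n k} → m ℕ.≤ n ℕ.+ k → ι m ≤ ι n + ι k
ι-≤-+ {m} {n} {k} m≤n+k = ≤-trans (ι-mono-≤ m≤n+k) (≤-reflexive (ι-+ n k))

ι-≤-++ : ∀ {m₁ m₂ n₁ n₂ k} → m₁ ℕ.+ m₂ ℕ.≤ n₁ ℕ.+ n₂ ℕ.+ k → ι m₁ + ι m₂ ≤ ι n₁ + ι n₂ + ι k
ι-≤-++ {m₁} {m₂} {n₁} {n₂} {k} m≤n = begin
  ι m₁ + ι m₂             ≡⟨ ι-+ m₁ m₂ ⟨
  ι (m₁ ℕ.+ m₂)           ≤⟨ ι-mono-≤ m≤n ⟩
  ι (n₁ ℕ.+ n₂ ℕ.+ k)     ≡⟨ trans (ι-+ (n₁ ℕ.+ n₂) k) (cong (_+ ι k) (ι-+ n₁ n₂)) ⟩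
  ι n₁ + ι n₂ + ι k       ∎
  where open ≤-Reasoning

infixl 6 _⊕_
infixl 7 _⊗_

_⊕_ : ∀ {p q} → 0ℚ ≤ p → 0ℚ ≤ q → 0ℚ ≤ p + q
_⊕_ = +-mono-≤

_⊗_ : ∀ {p q} → 0ℚ ≤ p → 0ℚ ≤ q → 0ℚ ≤ p * q
_⊗_ {p} {q} 0≤p 0≤q = nonNegative⁻¹ (p * q) {{nonNeg*nonNeg⇒nonNeg p {{nonNegative 0≤p}} q {{nonNegative 0≤q}}}}

0<-* : ∀ {p q} → 0ℚ < p → 0ℚ < q → 0ℚ < p * q
0<-* {p} {q} 0<p 0<q = positive⁻¹ (p * q) {{pos*pos⇒pos p {{positive 0<p}} q {{positive 0<q}}}}

0≤½ : 0ℚ ≤ ½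
0≤½ = ≤ᵇ⇒≤ _

0≤1 : 0ℚ ≤ 1ℚ
0≤1 = ≤ᵇ⇒≤ _

p≤q⇒0≤q-p : ∀ {p q} → p ≤ q → 0ℚ ≤ q - p
p≤q⇒0≤q-p {p} p≤q = ≤-trans (≤-reflexive (sym (+-inverseʳ p))) (+-monoˡ-≤ (- p) p≤q)

≤-byGap : ∀ {p q} g → q ≡ p + g → 0ℚ ≤ g → p ≤ q
≤-byGap {p} {q} g q≡p+g 0≤g = begin
  p        ≡⟨ +-identityʳ p ⟨
  p + 0ℚ   ≤⟨ +-monoʳ-≤ p 0≤g ⟩
  p + g    ≡⟨ q≡p+g ⟨
  q        ∎
  where open ≤-Reasoning

<-byGap : ∀ {p q} g → q ≡ p + g → 0ℚ < g → p < q
<-byGap {p} {q} g q≡p+g 0<g = begin-strict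
  p        ≡⟨ +-identityʳ p ⟨
  p + 0ℚ   <⟨ +-monoʳ-< p 0<g ⟩
  p + g    ≡⟨ q≡p+g ⟨
  q        ∎
  where open ≤-Reasoning

0-p≤0 : ∀ {p} → 0ℚ ≤ p → 0ℚ - p ≤ 0ℚ
0-p≤0 {p} = ≤-byGap p (solve 1 (λ p → con 0ℚ := (con 0ℚ :- p) :+ p) refl p)

0≤p*p : ∀ p → 0ℚ ≤ p * p
0≤p*p p with ≤-total 0ℚ p
... | inj₁ 0≤p = 0≤p ⊗ 0≤p
... | inj₂ p≤0 = ≤-trans (0≤0-p ⊗ 0≤0-p) (≤-reflexive (solve 1 (λ p → (con 0ℚ :- p) :* (con 0ℚ :- p) := p :* p) refl p))
  where
  0≤0-p : 0ℚ ≤ 0ℚ - p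
  0≤0-p = p≤q⇒0≤q-p p≤0

*-mono-≤-nonNeg : ∀ {p₁ q₁ p₂ q₂} → 0ℚ ≤ p₁ → p₁ ≤ q₁ → 0ℚ ≤ p₂ → p₂ ≤ q₂ → p₁ * p₂ ≤ q₁ * q₂
*-mono-≤-nonNeg {p₁} {q₁} {p₂} {q₂} 0≤p₁ p₁≤q₁ 0≤p₂ p₂≤q₂ = begin
  p₁ * p₂   ≤⟨ *-monoʳ-≤-nonNeg p₂ {{nonNegative 0≤p₂}} p₁≤q₁ ⟩
  q₁ * p₂   ≤⟨ *-monoˡ-≤-nonNeg q₁ {{nonNegative (≤-trans 0≤p₁ p₁≤q₁)}} p₂≤q₂ ⟩
  q₁ * q₂   ∎
  where open ≤-Reasoning

square-cancel-≤ : ∀ {p q} → 0ℚ ≤ q → p * p ≤ q * q → p ≤ q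
square-cancel-≤ {p} {q} 0≤q p²≤q² with p ≤? q
... | yes p≤q = p≤q
... | no p≰q = ⊥-elim (<-irrefl refl (<-≤-trans q²<p² p²≤q²))
  where
  q<p : q < p
  q<p = ≰⇒> p≰q
  q²<p² : q * q < p * p
  q²<p² = begin-strict
    q * q   ≤⟨ *-monoʳ-≤-nonNeg q {{nonNegative 0≤q}} (<⇒≤ q<p) ⟩
    p * q   <⟨ *-monoʳ-<-pos p {{positive (≤-<-trans 0≤q q<p)}} q<p ⟩
    p * p   ∎
    where open ≤-Reasoning

square-sum-≤ : ∀ I k {q r P} → 0ℚ ≤ q → 0ℚ ≤ r → 0ℚ ≤ P →
  I * I ≤ q * q * P → k * k ≤ r * r * P → (I + k) * (I + k) ≤ (q + r) * (q + r) * P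
square-sum-≤ I k {q} {r} {P} 0≤q 0≤r 0≤P I²≤ k²≤ =
  ≤-byGap _ (solve 5 (λ q r P I k → (q :+ r) :* (q :+ r) :* P := (I :+ k) :* (I :+ k) :+
                       ((q :* q :* P :- I :* I) :+ (r :* r :* P :- k :* k)
                        :+ (q :* r :* P :- I :* k) :+ (q :* r :* P :- I :* k))) refl q r P I k)
    (p≤q⇒0≤q-p I²≤ ⊕ p≤q⇒0≤q-p k²≤ ⊕ p≤q⇒0≤q-p Ik≤ ⊕ p≤q⇒0≤q-p Ik≤)
  where
  open ≤-Reasoning
  Ik≤ : I * k ≤ q * r * P
  Ik≤ = square-cancel-≤ (0≤q ⊗ 0≤r ⊗ 0≤P) (begin
    (I * k) * (I * k)                ≡⟨ solve 2 (λ I k → (I :* k) :* (I :* k) := (I :* I) :* (k :* k)) refl I k ⟩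
    (I * I) * (k * k)                ≤⟨ *-mono-≤-nonNeg (0≤p*p I) I²≤ (0≤p*p k) k²≤ ⟩
    (q * q * P) * (r * r * P)        ≡⟨ solve 3 (λ q r P → (q :* q :* P) :* (r :* r :* P) := (q :* r :* P) :* (q :* r :* P)) refl q r P ⟩
    (q * r * P) * (q * r * P)        ∎)

square-diff-≤ : ∀ {I} k {q r P} → 0ℚ ≤ r → r < q → 0ℚ ≤ I → 0ℚ ≤ P →
  q * q * P ≤ I * I → k * k ≤ r * r * P → k ≤ I × (q - r) * (q - r) * P ≤ (I - k) * (I - k)
square-diff-≤ {I} k {q} {r} {P} 0≤r r<q 0≤I 0≤P qqP≤ k²≤ = k≤I , diff²≤
  where
  open ≤-Reasoning
  0<q : 0ℚ < q
  0<q = ≤-<-trans 0≤r r<q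
  0≤q : 0ℚ ≤ q
  0≤q = <⇒≤ 0<q
  k≤I : k ≤ I
  k≤I = square-cancel-≤ 0≤I (begin
    k * k         ≤⟨ k²≤ ⟩
    r * r * P     ≤⟨ *-mono-≤-nonNeg (0≤r ⊗ 0≤r) (*-mono-≤-nonNeg 0≤r (<⇒≤ r<q) 0≤r (<⇒≤ r<q)) 0≤P ≤-refl ⟩
    q * q * P     ≤⟨ qqP≤ ⟩
    I * I         ∎)
  qk≤rI : q * k ≤ r * I
  qk≤rI = square-cancel-≤ (0≤r ⊗ 0≤I) (begin
    (q * k) * (q * k)              ≡⟨ solve 2 (λ q k → (q :* k) :* (q :* k) := (q :* q) :* (k :* k)) refl q k ⟩
    (q * q) * (k * k)              ≤⟨ *-mono-≤-nonNeg (0≤p*p q) ≤-refl (0≤p*p k) k²≤ ⟩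
    (q * q) * (r * r * P)          ≡⟨ solve 3 (λ q r P → (q :* q) :* (r :* r :* P) := (r :* r) :* (q :* q :* P)) refl q r P ⟩
    (r * r) * (q * q * P)          ≤⟨ *-mono-≤-nonNeg (0≤p*p r) ≤-refl (0≤q ⊗ 0≤q ⊗ 0≤P) qqP≤ ⟩
    (r * r) * (I * I)              ≡⟨ solve 2 (λ r I → (r :* r) :* (I :* I) := (r :* I) :* (r :* I)) refl r I ⟩
    (r * I) * (r * I)              ∎)
  diff*I≤ : (q - r) * I ≤ q * (I - k)
  diff*I≤ = ≤-byGap _ (solve 4 (λ q r I k → q :* (I :- k) := (q :- r) :* I :+ (r :* I :- q :* k)) refl q r I k)
                     (p≤q⇒0≤q-p qk≤rI)
  0≤[q-r]I : 0ℚ ≤ (q - r) * I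
  0≤[q-r]I = p≤q⇒0≤q-p (<⇒≤ r<q) ⊗ 0≤I
  diff²≤ : (q - r) * (q - r) * P ≤ (I - k) * (I - k)
  diff²≤ = *-cancelˡ-≤-pos (q * q) {{positive (0<-* 0<q 0<q)}} (begin
    q * q * ((q - r) * (q - r) * P)      ≡⟨ solve 3 (λ q r P → q :* q :* ((q :- r) :* (q :- r) :* P) :=
                                              (q :- r) :* (q :- r) :* (q :* q :* P)) refl q r P ⟩
    (q - r) * (q - r) * (q * q * P)      ≤⟨ *-mono-≤-nonNeg (0≤p*p (q - r)) ≤-refl (0≤q ⊗ 0≤q ⊗ 0≤P) qqP≤ ⟩
    (q - r) * (q - r) * (I * I)          ≡⟨ solve 3 (λ q r I → (q :- r) :* (q :- r) :* (I :* I) :=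
                                              ((q :- r) :* I) :* ((q :- r) :* I)) refl q r I ⟩
    ((q - r) * I) * ((q - r) * I)        ≤⟨ *-mono-≤-nonNeg 0≤[q-r]I diff*I≤ 0≤[q-r]I diff*I≤ ⟩
    (q * (I - k)) * (q * (I - k))        ≡⟨ solve 3 (λ q I k → (q :* (I :- k)) :* (q :* (I :- k)) :=
                                              q :* q :* ((I :- k) :* (I :- k))) refl q I k ⟩
    q * q * ((I - k) * (I - k))          ∎)

∣p∣≤q : ∀ {p q} → p ≤ q → - p ≤ q → ∣ p ∣ ≤ q
∣p∣≤q {p} p≤q -p≤q with ∣p∣≡p∨∣p∣≡-p p
... | inj₁ ∣p∣≡p  = ≤-trans (≤-reflexive ∣p∣≡p) p≤q
... | inj₂ ∣p∣≡-p = ≤-trans (≤-reflexive ∣p∣≡-p) -p≤q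

∣-∣-triangle : ∀ s p q {h r} → ∣ s - p ∣ ≤ h → ∣ p - q ∣ ≤ r → ∣ s - q ∣ ≤ h + r
∣-∣-triangle s p q ∣s-p∣≤h ∣p-q∣≤r = begin
  ∣ s - q ∣                 ≡⟨ cong ∣_∣ (solve 3 (λ s p q → s :- q := (s :- p) :+ (p :- q)) refl s p q) ⟩
  ∣ (s - p) + (p - q) ∣     ≤⟨ ∣p+q∣≤∣p∣+∣q∣ (s - p) (p - q) ⟩
  ∣ s - p ∣ + ∣ p - q ∣     ≤⟨ +-mono-≤ ∣s-p∣≤h ∣p-q∣≤r ⟩
  _                        ∎
  where open ≤-Reasoning

ratio-distance-≤ : ∀ X X′ {p p′ D D′ m r} → 0ℚ < D → 0ℚ < D′ → X * D ≡ p → X′ * D′ ≡ p′ →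
                   p * D′ ≤ p′ * D + m * D → p′ * D ≤ p * D′ + m * D → 0ℚ ≤ m → m ≤ r * D′ →
                   ∣ X - X′ ∣ ≤ r
ratio-distance-≤ X X′ {p} {p′} {D} {D′} {m} {r} 0<D 0<D′ XD≡p X′D′≡p′ pD′≤ p′D≤ 0≤m m≤rD′ =
  ∣p∣≤q (bound (X - X′) (p * D′) (p′ * D) (scaled X X′ XD≡p X′D′≡p′) pD′≤)
        (bound (- (X - X′)) (p′ * D) (p * D′) (trans (negate X X′) (scaled X′ X X′D′≡p′ XD≡p)) p′D≤)
  where
  open ≤-Reasoning
  scaled : ∀ Y Y′ {q q′ E E′} → Y * E ≡ q → Y′ * E′ ≡ q′ → (Y - Y′) * (E * E′) ≡ q * E′ - q′ * E
  scaled Y Y′ {E = E} {E′} refl refl =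
    solve 4 (λ Y Y′ E E′ → (Y :- Y′) :* (E :* E′) := Y :* E :* E′ :- Y′ :* E′ :* E) refl Y Y′ E E′
  negate : ∀ Y Y′ → - (Y - Y′) * (D * D′) ≡ (Y′ - Y) * (D′ * D)
  negate Y Y′ = solve 4 (λ Y Y′ D D′ → (:- (Y :- Y′)) :* (D :* D′) := (Y′ :- Y) :* (D′ :* D)) refl Y Y′ D D′
  bound : ∀ Z q q′ → Z * (D * D′) ≡ q - q′ → q ≤ q′ + m * D → Z ≤ r
  bound Z q q′ ZDD′≡ q≤ = *-cancelʳ-≤-pos (D * D′) {{positive (0<-* 0<D 0<D′)}} (begin
    Z * (D * D′)    ≡⟨ ZDD′≡ ⟩
    q - q′          ≤⟨ ≤-byGap _ (solve 3 (λ q q′ g → g := q :- q′ :+ (q′ :+ g :- q)) refl q q′ (m * D)) (p≤q⇒0≤q-p q≤) ⟩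
    m * D           ≤⟨ *-monoʳ-≤-nonNeg D {{nonNegative (<⇒≤ 0<D)}} m≤rD′ ⟩
    r * D′ * D      ≡⟨ solve 3 (λ r D D′ → r :* D′ :* D := r :* (D :* D′)) refl r D D′ ⟩
    r * (D * D′)    ∎)

∣0-ratio∣≤ : ∀ X {p D r} → 0ℚ < D → X * D ≡ p → 0ℚ ≤ p → p ≤ r * D → 0ℚ ≤ r → ∣ 0ℚ - X ∣ ≤ r
∣0-ratio∣≤ X {p} {D} {r} 0<D XD≡p 0≤p p≤rD 0≤r =
  ∣p∣≤q (≤-trans (0-p≤0 0≤X) 0≤r) (≤-trans (≤-reflexive (solve 1 (λ X → :- (con 0ℚ :- X) := X) refl X)) X≤r)
  where
  cancel : ∀ {p q} → p * D ≤ q * D → p ≤ q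
  cancel = *-cancelʳ-≤-pos D {{positive 0<D}}
  0≤X : 0ℚ ≤ X
  0≤X = cancel (≤-trans (≤-reflexive (*-zeroˡ D)) (≤-trans 0≤p (≤-reflexive (sym XD≡p))))
  X≤r : X ≤ r
  X≤r = cancel (≤-trans (≤-reflexive XD≡p) p≤rD)

-- Each inequality p ≤ q below is proved by writing q − p, with the ring solver, as a sum of products of
-- terms that are nonnegative by hypothesis.
module Bounds (a b I T a′ b′ I′ T′ k r : ℚ) (0≤r : 0ℚ ≤ r) (r≤½ : r ≤ ½) where

  jaccard-small-bound : 0ℚ ≤ b →
    I′ ≤ a′ → a′ ≤ a + k → b ≤ b′ + k → b′ ≤ T′ → a ≤ r * r * b → k ≤ r * r * b →
    I′ ≤ (r + r) * T′
  jaccard-small-bound 0≤b I′≤a′ a′≤a+k b≤b′+k b′≤T′ a≤rrb k≤rrb =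
    ≤-byGap _ (solve 8 (λ I′ a′ a k b b′ T′ r → (r :+ r) :* T′ := I′ :+
        ((a′ :- I′) :+ ((a :+ k) :- a′) :+ (r :* r :* b :- a) :+ (r :* r :* b :- k)
         :+ (r :+ r) :* (T′ :- b′) :+ (r :+ r) :* ((b′ :+ k) :- b)
         :+ (r :+ r) :* ((r :* r :* b :- k) :+ b :* ((con ½ :- r) :* (con 1ℚ :+ con ½ :+ r) :+ con ½ :* con ½)))) refl I′ a′ a k b b′ T′ r)
      (p≤q⇒0≤q-p I′≤a′ ⊕ p≤q⇒0≤q-p a′≤a+k ⊕ p≤q⇒0≤q-p a≤rrb ⊕ p≤q⇒0≤q-p k≤rrb
       ⊕ (0≤r ⊕ 0≤r) ⊗ p≤q⇒0≤q-p b′≤T′ ⊕ (0≤r ⊕ 0≤r) ⊗ p≤q⇒0≤q-p b≤b′+k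
       ⊕ (0≤r ⊕ 0≤r) ⊗ (p≤q⇒0≤q-p k≤rrb ⊕ 0≤b ⊗ (p≤q⇒0≤q-p r≤½ ⊗ (0≤1 ⊕ 0≤½ ⊕ 0≤r) ⊕ 0≤½ ⊗ 0≤½)))

  dice-small-bound : 0ℚ ≤ b →
    I′ ≤ a′ → a′ ≤ a + k → a′ + b ≤ a + b′ + k → a ≤ r * r * b → k ≤ r * r * b →
    I′ + I′ ≤ (r + r) * (a′ + b′)
  dice-small-bound 0≤b I′≤a′ a′≤a+k a′+b≤ a≤rrb k≤rrb =
    ≤-byGap _ (solve 7 (λ I′ a′ a k b b′ r → (r :+ r) :* (a′ :+ b′) := I′ :+ I′ :+
        ((a′ :- I′) :+ (a′ :- I′) :+ (r :+ r) :* ((a :+ b′ :+ k) :- (a′ :+ b))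
         :+ (con 1ℚ :+ con 1ℚ :+ con 1ℚ :+ con 1ℚ) :* (con ½ :- r) :* ((a :+ k) :- a′)
         :+ ((con 1ℚ :+ con 1ℚ) :* (con ½ :- r) :+ con 1ℚ) :* ((r :* r :* b :- a) :+ (r :* r :* b :- k))
         :+ r :* b :* ((con 1ℚ :- (r :+ r)) :* (con 1ℚ :- (r :+ r)) :+ con 1ℚ))) refl I′ a′ a k b b′ r)
      (p≤q⇒0≤q-p I′≤a′ ⊕ p≤q⇒0≤q-p I′≤a′ ⊕ (0≤r ⊕ 0≤r) ⊗ p≤q⇒0≤q-p a′+b≤
       ⊕ (0≤1 ⊕ 0≤1 ⊕ 0≤1 ⊕ 0≤1) ⊗ p≤q⇒0≤q-p r≤½ ⊗ p≤q⇒0≤q-p a′≤a+k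
       ⊕ ((0≤1 ⊕ 0≤1) ⊗ p≤q⇒0≤q-p r≤½ ⊕ 0≤1) ⊗ (p≤q⇒0≤q-p a≤rrb ⊕ p≤q⇒0≤q-p k≤rrb)
       ⊕ 0≤r ⊗ 0≤b ⊗ (0≤p*p (1ℚ - (r + r)) ⊕ 0≤1))

  cosine-small-bound : 0ℚ ≤ b →
    a′ ≤ a + k → b ≤ b′ + k → a ≤ r * r * b → k ≤ r * r * b →
    a′ ≤ (r + r) * (r + r) * b′
  cosine-small-bound 0≤b a′≤a+k b≤b′+k a≤rrb k≤rrb =
    ≤-byGap _ (solve 6 (λ a′ a k b b′ r → (r :+ r) :* (r :+ r) :* b′ := a′ :+
        ((r :+ r) :* (r :+ r) :* ((b′ :+ k) :- b) :+ ((a :+ k) :- a′)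
         :+ (r :* r :* b :- a) :+ (r :* r :* b :- k)
         :+ (r :+ r) :* (r :+ r) :* ((r :* r :* b :- k) :+ b :* ((con ½ :- r) :* (con ½ :+ r) :+ con ½ :* con ½)))) refl a′ a k b b′ r)
      ((0≤r ⊕ 0≤r) ⊗ (0≤r ⊕ 0≤r) ⊗ p≤q⇒0≤q-p b≤b′+k ⊕ p≤q⇒0≤q-p a′≤a+k
       ⊕ p≤q⇒0≤q-p a≤rrb ⊕ p≤q⇒0≤q-p k≤rrb
       ⊕ (0≤r ⊕ 0≤r) ⊗ (0≤r ⊕ 0≤r) ⊗ (p≤q⇒0≤q-p k≤rrb ⊕ 0≤b ⊗ (p≤q⇒0≤q-p r≤½ ⊗ (0≤½ ⊕ 0≤r) ⊕ 0≤½ ⊗ 0≤½)))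

  jaccard-updates-bound : 0ℚ ≤ b →
    b ≤ b′ + k → b′ ≤ T′ → k ≤ r * r * b → k ≤ r * T′
  jaccard-updates-bound 0≤b b≤b′+k b′≤T′ k≤rrb =
    ≤-byGap _ (solve 5 (λ k b b′ T′ r → r :* T′ := k :+
        (r :* (T′ :- b′) :+ r :* ((b′ :+ k) :- b) :+ (con 1ℚ :+ r) :* (r :* r :* b :- k)
         :+ r :* b :* ((con ½ :- r) :* (con 1ℚ :+ con ½ :+ r) :+ con ½ :* con ½))) refl k b b′ T′ r)
      (0≤r ⊗ p≤q⇒0≤q-p b′≤T′ ⊕ 0≤r ⊗ p≤q⇒0≤q-p b≤b′+k ⊕ (0≤1 ⊕ 0≤r) ⊗ p≤q⇒0≤q-p k≤rrb
       ⊕ 0≤r ⊗ 0≤b ⊗ (p≤q⇒0≤q-p r≤½ ⊗ (0≤1 ⊕ 0≤½ ⊕ 0≤r) ⊕ 0≤½ ⊗ 0≤½))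

  dice-updates-bound : 0ℚ ≤ b →
    a + b ≤ a′ + b′ + k → k ≤ r * r * b → r * r * b ≤ a → k + k ≤ r * (a′ + b′)
  dice-updates-bound 0≤b a+b≤ k≤rrb rrb≤a =
    ≤-byGap _ (solve 6 (λ k a b a′ b′ r → r :* (a′ :+ b′) := k :+ k :+
        (r :* ((a′ :+ b′ :+ k) :- (a :+ b)) :+ r :* ((a :- r :* r :* b) :+ (r :* r :* b :- k))
         :+ (con 1ℚ :+ con 1ℚ) :* (r :* r :* b :- k) :+ (con 1ℚ :+ con 1ℚ) :* r :* b :* (con ½ :- r))) refl k a b a′ b′ r)
      (0≤r ⊗ p≤q⇒0≤q-p a+b≤ ⊕ 0≤r ⊗ (p≤q⇒0≤q-p rrb≤a ⊕ p≤q⇒0≤q-p k≤rrb)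
       ⊕ (0≤1 ⊕ 0≤1) ⊗ p≤q⇒0≤q-p k≤rrb ⊕ (0≤1 ⊕ 0≤1) ⊗ 0≤r ⊗ 0≤b ⊗ p≤q⇒0≤q-p r≤½)

  cosine-updates-bound : 0ℚ ≤ k → 0ℚ ≤ b →
    k ≤ r * r * b → r * r * b ≤ a → k * k ≤ r * r * (a * b)
  cosine-updates-bound 0≤k 0≤b k≤rrb rrb≤a = begin
    k * k                      ≤⟨ *-mono-≤-nonNeg 0≤k k≤rrb 0≤k k≤rrb ⟩
    r * r * b * (r * r * b)    ≤⟨ ≤-byGap _
                                    (solve 3 (λ a b r → r :* r :* (a :* b) :=
                                       r :* r :* b :* (r :* r :* b) :+ r :* r :* b :* (a :- r :* r :* b)) refl a b r)
                                    (0≤r ⊗ 0≤r ⊗ 0≤b ⊗ p≤q⇒0≤q-p rrb≤a) ⟩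
    r * r * (a * b)            ∎
    where open ≤-Reasoning

  jaccard-cross-bound₁ : 0ℚ ≤ I → I ≤ T →
    T′ + I ≤ T + I′ + k → T + I ≤ T′ + I′ + k → I * T′ ≤ I′ * T + k * T
  jaccard-cross-bound₁ 0≤I I≤T T′+I≤ T+I≤ =
    ≤-byGap _ (solve 5 (λ I T I′ T′ k → I′ :* T :+ k :* T := I :* T′ :+
        (con ½ :* ((T :- I) :+ I :+ I) :* ((T :+ I′ :+ k) :- (T′ :+ I))
         :+ con ½ :* (T :- I) :* ((T′ :+ I′ :+ k) :- (T :+ I)))) refl I T I′ T′ k)
      (0≤½ ⊗ (p≤q⇒0≤q-p I≤T ⊕ 0≤I ⊕ 0≤I) ⊗ p≤q⇒0≤q-p T′+I≤ ⊕ 0≤½ ⊗ p≤q⇒0≤q-p I≤T ⊗ p≤q⇒0≤q-p T+I≤)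

  jaccard-cross-bound₂ : 0ℚ ≤ I → I ≤ T →
    I′ + T ≤ I + T′ + k → I′ + T′ ≤ I + T + k → I′ * T ≤ I * T′ + k * T
  jaccard-cross-bound₂ 0≤I I≤T I′+T≤ I′+T′≤ =
    ≤-byGap _ (solve 5 (λ I T I′ T′ k → I :* T′ :+ k :* T := I′ :* T :+
        (con ½ :* ((T :- I) :+ I :+ I) :* ((I :+ T′ :+ k) :- (I′ :+ T))
         :+ con ½ :* (T :- I) :* ((I :+ T :+ k) :- (I′ :+ T′)))) refl I T I′ T′ k)
      (0≤½ ⊗ (p≤q⇒0≤q-p I≤T ⊕ 0≤I ⊕ 0≤I) ⊗ p≤q⇒0≤q-p I′+T≤ ⊕ 0≤½ ⊗ p≤q⇒0≤q-p I≤T ⊗ p≤q⇒0≤q-p I′+T′≤)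

  dice-cross-bound₁ : 0ℚ ≤ I → 0ℚ ≤ k → I * T′ ≤ I′ * T + k * T →
    (I + I) * (I′ + T′) ≤ (I′ + I′) * (I + T) + (k + k) * (I + T)
  dice-cross-bound₁ 0≤I 0≤k IT′≤ =
    ≤-byGap _ (solve 5 (λ I T I′ T′ k → (I′ :+ I′) :* (I :+ T) :+ (k :+ k) :* (I :+ T) := (I :+ I) :* (I′ :+ T′) :+
        (((I′ :* T :+ k :* T) :- I :* T′) :+ ((I′ :* T :+ k :* T) :- I :* T′) :+ (k :+ k) :* I)) refl I T I′ T′ k)
      (p≤q⇒0≤q-p IT′≤ ⊕ p≤q⇒0≤q-p IT′≤ ⊕ (0≤k ⊕ 0≤k) ⊗ 0≤I)

  dice-cross-bound₂ : 0ℚ ≤ I → 0ℚ ≤ k → I′ * T ≤ I * T′ + k * T →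
    (I′ + I′) * (I + T) ≤ (I + I) * (I′ + T′) + (k + k) * (I + T)
  dice-cross-bound₂ 0≤I 0≤k I′T≤ =
    ≤-byGap _ (solve 5 (λ I T I′ T′ k → (I :+ I) :* (I′ :+ T′) :+ (k :+ k) :* (I :+ T) := (I′ :+ I′) :* (I :+ T) :+
        (((I :* T′ :+ k :* T) :- I′ :* T) :+ ((I :* T′ :+ k :* T) :- I′ :* T) :+ (k :+ k) :* I)) refl I T I′ T′ k)
      (p≤q⇒0≤q-p I′T≤ ⊕ p≤q⇒0≤q-p I′T≤ ⊕ (0≤k ⊕ 0≤k) ⊗ 0≤I)

  -- In square-root-free form: I′ / √(a′b′) ≤ (I + k) / √(ab). With D = I + k − I′ the hypotheses give
  -- a′ ≥ max(I′, a − D) and b′ ≥ max(I′, b − D); the cases are the positions of I′ relative to a − D ≤ b − D.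
  cosine-upper : 0ℚ ≤ I′ → 0ℚ ≤ a′ → 0ℚ ≤ b → I′ ≤ a′ → I′ ≤ b′ →
    I′ + a ≤ I + a′ + k → I′ + b ≤ I + b′ + k → I′ ≤ I + k → a ≤ b →
    I′ * I′ * (a * b) ≤ (I + k) * (I + k) * (a′ * b′)
  cosine-upper 0≤I′ 0≤a′ 0≤b I′≤a′ I′≤b′ I′+a≤ I′+b≤ I′≤I+k a≤b = by-cases (I′ ≤? a - D) (I′ ≤? b - D)
    where
    D : ℚ
    D = I + k - I′
    0≤D : 0ℚ ≤ D
    0≤D = p≤q⇒0≤q-p I′≤I+k
    0≤b-a : 0ℚ ≤ b - a
    0≤b-a = p≤q⇒0≤q-p a≤b
    by-cases : Dec (I′ ≤ a - D) → Dec (I′ ≤ b - D) → I′ * I′ * (a * b) ≤ (I + k) * (I + k) * (a′ * b′)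
    by-cases (yes I′≤a-D) _ = ≤-byGap _
      (solve 7 (λ I a b I′ a′ b′ k →
        let D = (I :+ k) :- I′
            c = (a :- D) :- I′
        in (I :+ k) :* (I :+ k) :* (a′ :* b′) := I′ :* I′ :* (a :* b) :+
           (D :* (I′ :* (c :+ I′) :* ((b :- a) :+ c) :+ I′ :* ((b :- a) :+ c :+ I′) :* c
                  :+ D :* ((c :+ I′) :* ((b :- a) :+ c) :+ I′ :* c))
            :+ (I′ :+ D) :* (I′ :+ D) :* (a′ :* ((I :+ b′ :+ k) :- (I′ :+ b))
                                          :+ ((b :- a) :+ c :+ I′) :* ((I :+ a′ :+ k) :- (I′ :+ a))))) refl I a b I′ a′ b′ k)
      (0≤D ⊗ (0≤I′ ⊗ (0≤c ⊕ 0≤I′) ⊗ (0≤b-a ⊕ 0≤c) ⊕ 0≤I′ ⊗ (0≤b-a ⊕ 0≤c ⊕ 0≤I′) ⊗ 0≤c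
              ⊕ 0≤D ⊗ ((0≤c ⊕ 0≤I′) ⊗ (0≤b-a ⊕ 0≤c) ⊕ 0≤I′ ⊗ 0≤c))
       ⊕ (0≤I′ ⊕ 0≤D) ⊗ (0≤I′ ⊕ 0≤D) ⊗ (0≤a′ ⊗ p≤q⇒0≤q-p I′+b≤ ⊕ (0≤b-a ⊕ 0≤c ⊕ 0≤I′) ⊗ p≤q⇒0≤q-p I′+a≤))
      where
      0≤c : 0ℚ ≤ a - D - I′
      0≤c = p≤q⇒0≤q-p I′≤a-D
    by-cases (no I′≰a-D) (yes I′≤b-D) = ≤-byGap _
      (solve 7 (λ I a b I′ a′ b′ k →
        let D = (I :+ k) :- I′
            c₁ = I′ :- (a :- D)
            c₂ = (b :- D) :- I′
        in (I :+ k) :* (I :+ k) :* (a′ :* b′) := I′ :* I′ :* (a :* b) :+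
           (I′ :* I′ :* (c₂ :+ I′ :+ D) :* c₁ :+ I′ :* (I′ :+ D) :* D :* c₂
            :+ (I′ :+ D) :* (I′ :+ D) :* (a′ :* ((I :+ b′ :+ k) :- (I′ :+ b)) :+ (c₂ :+ I′) :* (a′ :- I′)))) refl I a b I′ a′ b′ k)
      (0≤I′ ⊗ 0≤I′ ⊗ (0≤c₂ ⊕ 0≤I′ ⊕ 0≤D) ⊗ 0≤c₁ ⊕ 0≤I′ ⊗ (0≤I′ ⊕ 0≤D) ⊗ 0≤D ⊗ 0≤c₂
       ⊕ (0≤I′ ⊕ 0≤D) ⊗ (0≤I′ ⊕ 0≤D) ⊗ (0≤a′ ⊗ p≤q⇒0≤q-p I′+b≤ ⊕ (0≤c₂ ⊕ 0≤I′) ⊗ p≤q⇒0≤q-p I′≤a′))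
      where
      0≤c₁ : 0ℚ ≤ I′ - (a - D)
      0≤c₁ = p≤q⇒0≤q-p (<⇒≤ (≰⇒> I′≰a-D))
      0≤c₂ : 0ℚ ≤ b - D - I′
      0≤c₂ = p≤q⇒0≤q-p I′≤b-D
    by-cases (no I′≰a-D) (no I′≰b-D) = ≤-byGap _
      (solve 7 (λ I a b I′ a′ b′ k →
        let D = (I :+ k) :- I′
        in (I :+ k) :* (I :+ k) :* (a′ :* b′) := I′ :* I′ :* (a :* b) :+
           (I′ :* I′ :* ((I′ :+ D) :* (I′ :- (b :- D)) :+ b :* (I′ :- (a :- D)))
            :+ (I′ :+ D) :* (I′ :+ D) :* (a′ :* (b′ :- I′) :+ I′ :* (a′ :- I′)))) refl I a b I′ a′ b′ k)
      (0≤I′ ⊗ 0≤I′ ⊗ ((0≤I′ ⊕ 0≤D) ⊗ 0≤c₂ ⊕ 0≤b ⊗ 0≤c₁)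
       ⊕ (0≤I′ ⊕ 0≤D) ⊗ (0≤I′ ⊕ 0≤D) ⊗ (0≤a′ ⊗ p≤q⇒0≤q-p I′≤b′ ⊕ 0≤I′ ⊗ p≤q⇒0≤q-p I′≤a′))
      where
      0≤c₁ : 0ℚ ≤ I′ - (a - D)
      0≤c₁ = p≤q⇒0≤q-p (<⇒≤ (≰⇒> I′≰a-D))
      0≤c₂ : 0ℚ ≤ I′ - (b - D)
      0≤c₂ = p≤q⇒0≤q-p (<⇒≤ (≰⇒> I′≰b-D))

  -- In square-root-free form: (I − k) / √(ab) ≤ I′ / √(a′b′).
  cosine-lower : 0ℚ ≤ k → 0ℚ ≤ b′ →
    I + a′ ≤ a + I′ + k → I + b′ ≤ b + I′ + k → I ≤ I′ + k → k ≤ I → I ≤ a → a ≤ b →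
    (I - k) * (I - k) * (a′ * b′) ≤ I′ * I′ * (a * b)
  cosine-lower 0≤k 0≤b′ I+a′≤ I+b′≤ I≤I′+k k≤I I≤a a≤b =
    ≤-byGap _ (solve 7 (λ I a b I′ a′ b′ k →
        let P = (I′ :+ k) :- I
            K = I :- k
            A = (a :- I) :+ K :+ k
        in I′ :* I′ :* (a :* b) := (I :- k) :* (I :- k) :* (a′ :* b′) :+
           (P :* (K :* A :* ((b :- a) :+ (a :- I) :+ k) :+ K :* ((b :- a) :+ A) :* ((a :- I) :+ k)
                  :+ P :* (A :* ((b :- a) :+ (a :- I) :+ k) :+ K :* ((a :- I) :+ k)))
            :+ K :* K :* ((A :+ P) :* ((b :+ I′ :+ k) :- (I :+ b′)) :+ b′ :* ((a :+ I′ :+ k) :- (I :+ a′))))) refl I a b I′ a′ b′ k)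
      (0≤P ⊗ (0≤K ⊗ 0≤A ⊗ (0≤b-a ⊕ 0≤a-I ⊕ 0≤k) ⊕ 0≤K ⊗ (0≤b-a ⊕ 0≤A) ⊗ (0≤a-I ⊕ 0≤k)
              ⊕ 0≤P ⊗ (0≤A ⊗ (0≤b-a ⊕ 0≤a-I ⊕ 0≤k) ⊕ 0≤K ⊗ (0≤a-I ⊕ 0≤k)))
       ⊕ 0≤K ⊗ 0≤K ⊗ ((0≤A ⊕ 0≤P) ⊗ p≤q⇒0≤q-p I+b′≤ ⊕ 0≤b′ ⊗ p≤q⇒0≤q-p I+a′≤))
    where
    0≤P : 0ℚ ≤ I′ + k - I
    0≤P = p≤q⇒0≤q-p I≤I′+k
    0≤K : 0ℚ ≤ I - k
    0≤K = p≤q⇒0≤q-p k≤I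
    0≤a-I : 0ℚ ≤ a - I
    0≤a-I = p≤q⇒0≤q-p I≤a
    0≤b-a : 0ℚ ≤ b - a
    0≤b-a = p≤q⇒0≤q-p a≤b
    0≤A : 0ℚ ≤ a - I + (I - k) + k
    0≤A = 0≤a-I ⊕ 0≤K ⊕ 0≤k

module _ (C : Counts) where
  open Counts C

  σ-jaccard σ-dice : ℚ
  σ-jaccard = frac I (a ℕ.+ b ℕ.∸ I)
  σ-dice    = frac (2 ℕ.* I) (a ℕ.+ b)

  0<ιT : 0ℚ < ι T
  0<ιT = 0<ι (ℕₚ.≤-trans 1≤b b≤T)

  ιa+ιb≡ιI+ιT : ι a + ι b ≡ ι I + ι T
  ιa+ιb≡ιI+ιT = trans (sym (ι-+ a b)) (trans (cong ι a+b≡I+T) (ι-+ I T))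

  0<ιI+ιT : 0ℚ < ι I + ι T
  0<ιI+ιT = subst (0ℚ <_) (trans (ι-+ a b) ιa+ιb≡ιI+ιT) (0<ι (ℕₚ.≤-trans 1≤a (ℕₚ.m≤m+n a b)))

  jaccard-ratio : σ-jaccard * ι T ≡ ι I
  jaccard-ratio = subst (λ D → frac I D * ι T ≡ ι I) (sym a+b∸I≡T) (frac-*-ι I (ℕₚ.≤-trans 1≤b b≤T))
    where
    a+b∸I≡T : a ℕ.+ b ℕ.∸ I ≡ T
    a+b∸I≡T = trans (cong (ℕ._∸ I) a+b≡I+T) (ℕₚ.m+n∸m≡n I T)

  dice-ratio : σ-dice * (ι I + ι T) ≡ ι I + ι I
  dice-ratio = begin
    σ-dice * (ι I + ι T)     ≡⟨ cong (σ-dice *_) (trans (ι-+ a b) ιa+ιb≡ιI+ιT) ⟨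
    σ-dice * ι (a ℕ.+ b)     ≡⟨ frac-*-ι (2 ℕ.* I) (ℕₚ.≤-trans 1≤a (ℕₚ.m≤m+n a b)) ⟩
    ι (2 ℕ.* I)              ≡⟨ ι-* 2 I ⟩
    ι 2 * ι I                ≡⟨ solve 1 (λ x → con (ι 2) :* x := x :+ x) refl (ι I) ⟩
    ι I + ι I                ∎
    where open ≡-Reasoning

Approxᶜ : Measure → Counts → ℚ → ℚ → Set
Approxᶜ jaccard C s ρ = ∣ s - σ-jaccard C ∣ ≤ ρ
Approxᶜ cosine  C s ρ = CosApprox s ρ (Counts.I C) (Counts.a C ℕ.* Counts.b C)
Approxᶜ dice    C s ρ = ∣ s - σ-dice C ∣ ≤ ρ

Approx≡Approxᶜ : ∀ {V} (H : Graph V) u v m {s ρ} → Approx m H u v s ρ ≡ Approxᶜ m (graph-counts H u v) s ρ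
Approx≡Approxᶜ H u v jaccard = refl
Approx≡Approxᶜ H u v cosine  = refl
Approx≡Approxᶜ H u v dice    = refl

module Affordability {ρ : ℚ} (0<ρ : 0ℚ < ρ) (ρ<1 : ρ < 1ℚ) {C C′ : Counts} {k : ℕ}
                     (a≤b : Counts.a C ℕ.≤ Counts.b C) (drift : Drift C C′ k) where
  open Counts C
  open Counts C′ using () renaming (a to a′; b to b′; I to I′; T to T′; I≤a to I′≤a′; I≤b to I′≤b′; b≤T to b′≤T′)
  open Drift drift

  r : ℚ
  r = ½ * ρ

  0≤r : 0ℚ ≤ r
  0≤r = 0≤½ ⊗ <⇒≤ 0<ρ

  r≤½ : r ≤ ½
  r≤½ = ≤-byGap (½ * (1ℚ - ρ)) (solve 1 (λ ρ → con ½ := con ½ :* ρ :+ con ½ :* (con 1ℚ :- ρ)) refl ρ)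
                (0≤½ ⊗ p≤q⇒0≤q-p (<⇒≤ ρ<1))

  open Bounds (ι a) (ι b) (ι I) (ι T) (ι a′) (ι b′) (ι I′) (ι T′) (ι k) r 0≤r r≤½

  ιa′≤a+k : ι a′ ≤ ι a + ι k
  ιa′≤a+k = ι-≤-+ {a′} {a} {k} a′≤a+k
  ιb≤b′+k : ι b ≤ ι b′ + ι k
  ιb≤b′+k = ι-≤-+ {b} {b′} {k} b≤b′+k
  ιa′+b≤a+b′+k : ι a′ + ι b ≤ ι a + ι b′ + ι k
  ιa′+b≤a+b′+k = ι-≤-++ {a′} {b} {a} {b′} {k} a′+b≤a+b′+k
  ιa+b≤a′+b′+k : ι a + ι b ≤ ι a′ + ι b′ + ι k
  ιa+b≤a′+b′+k = ι-≤-++ {a} {b} {a′} {b′} {k} a+b≤a′+b′+k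
  ιI′≤I+k : ι I′ ≤ ι I + ι k
  ιI′≤I+k = ι-≤-+ {I′} {I} {k} I′≤I+k
  ιI≤I′+k : ι I ≤ ι I′ + ι k
  ιI≤I′+k = ι-≤-+ {I} {I′} {k} I≤I′+k
  ιI′+a≤I+a′+k : ι I′ + ι a ≤ ι I + ι a′ + ι k
  ιI′+a≤I+a′+k = ι-≤-++ {I′} {a} {I} {a′} {k} I′+a≤I+a′+k
  ιI′+b≤I+b′+k : ι I′ + ι b ≤ ι I + ι b′ + ι k
  ιI′+b≤I+b′+k = ι-≤-++ {I′} {b} {I} {b′} {k} I′+b≤I+b′+k
  ιI+a′≤a+I′+k : ι I + ι a′ ≤ ι a + ι I′ + ι k
  ιI+a′≤a+I′+k = ι-≤-++ {I} {a′} {a} {I′} {k} I+a′≤a+I′+k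
  ιI+b′≤b+I′+k : ι I + ι b′ ≤ ι b + ι I′ + ι k
  ιI+b′≤b+I′+k = ι-≤-++ {I} {b′} {b} {I′} {k} I+b′≤b+I′+k
  ιT′+I≤T+I′+k : ι T′ + ι I ≤ ι T + ι I′ + ι k
  ιT′+I≤T+I′+k = ι-≤-++ {T′} {I} {T} {I′} {k} T′+I≤T+I′+k
  ιT+I≤T′+I′+k : ι T + ι I ≤ ι T′ + ι I′ + ι k
  ιT+I≤T′+I′+k = ι-≤-++ {T} {I} {T′} {I′} {k} T+I≤T′+I′+k
  ιI′+T≤I+T′+k : ι I′ + ι T ≤ ι I + ι T′ + ι k
  ιI′+T≤I+T′+k = ι-≤-++ {I′} {T} {I} {T′} {k} I′+T≤I+T′+k
  ιI′+T′≤I+T+k : ι I′ + ι T′ ≤ ι I + ι T + ι k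
  ιI′+T′≤I+T+k = ι-≤-++ {I′} {T′} {I} {T} {k} I′+T′≤I+T+k

  ιI≤ιT : ι I ≤ ι T
  ιI≤ιT = ι-mono-≤ (ℕₚ.≤-trans I≤b b≤T)

  jaccard-small : ι a ≤ r * r * ι b → ι k ≤ r * r * ι b → Approxᶜ jaccard C′ 0ℚ (r + r)
  jaccard-small a≤rrb k≤rrb = ∣0-ratio∣≤ (σ-jaccard C′) (0<ιT C′) (jaccard-ratio C′) (0≤ι I′)
    (jaccard-small-bound (0≤ι b) (ι-mono-≤ I′≤a′) ιa′≤a+k ιb≤b′+k (ι-mono-≤ b′≤T′) a≤rrb k≤rrb)
    (0≤r ⊕ 0≤r)

  jaccard-large : ∀ {s} → ι k ≤ r * r * ι b → Approxᶜ jaccard C s r → Approxᶜ jaccard C′ s (r + r)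
  jaccard-large {s} k≤rrb ∣s-σ∣≤r = ∣-∣-triangle s (σ-jaccard C) (σ-jaccard C′) ∣s-σ∣≤r
    (ratio-distance-≤ (σ-jaccard C) (σ-jaccard C′) (0<ιT C) (0<ιT C′) (jaccard-ratio C) (jaccard-ratio C′)
      (jaccard-cross-bound₁ (0≤ι I) ιI≤ιT ιT′+I≤T+I′+k ιT+I≤T′+I′+k)
      (jaccard-cross-bound₂ (0≤ι I) ιI≤ιT ιI′+T≤I+T′+k ιI′+T′≤I+T+k)
      (0≤ι k)
      (jaccard-updates-bound (0≤ι b) ιb≤b′+k (ι-mono-≤ b′≤T′) k≤rrb))

  dice-small : ι a ≤ r * r * ι b → ι k ≤ r * r * ι b → Approxᶜ dice C′ 0ℚ (r + r)
  dice-small a≤rrb k≤rrb = ∣0-ratio∣≤ (σ-dice C′) (0<ιI+ιT C′) (dice-ratio C′) (0≤ι I′ ⊕ 0≤ι I′)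
    (subst (λ D → ι I′ + ι I′ ≤ (r + r) * D) (ιa+ιb≡ιI+ιT C′)
      (dice-small-bound (0≤ι b) (ι-mono-≤ I′≤a′) ιa′≤a+k ιa′+b≤a+b′+k a≤rrb k≤rrb))
    (0≤r ⊕ 0≤r)

  dice-large : ∀ {s} → ι k ≤ r * r * ι b → r * r * ι b ≤ ι a → Approxᶜ dice C s r → Approxᶜ dice C′ s (r + r)
  dice-large {s} k≤rrb rrb≤a ∣s-σ∣≤r = ∣-∣-triangle s (σ-dice C) (σ-dice C′) ∣s-σ∣≤r
    (ratio-distance-≤ (σ-dice C) (σ-dice C′) (0<ιI+ιT C) (0<ιI+ιT C′) (dice-ratio C) (dice-ratio C′)
      (dice-cross-bound₁ (0≤ι I) (0≤ι k) (jaccard-cross-bound₁ (0≤ι I) ιI≤ιT ιT′+I≤T+I′+k ιT+I≤T′+I′+k))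
      (dice-cross-bound₂ (0≤ι I) (0≤ι k) (jaccard-cross-bound₂ (0≤ι I) ιI≤ιT ιI′+T≤I+T′+k ιI′+T′≤I+T+k))
      (0≤ι k ⊕ 0≤ι k)
      (subst (λ D → ι k + ι k ≤ r * D) (ιa+ιb≡ιI+ιT C′)
        (dice-updates-bound (0≤ι b) ιa+b≤a′+b′+k k≤rrb rrb≤a)))
  P X : ℚ
  P = ι a * ι b
  X = ι a′ * ι b′

  0<P : 0ℚ < P
  0<P = 0<-* (0<ι 1≤a) (0<ι 1≤b)

  0≤P : 0ℚ ≤ P
  0≤P = <⇒≤ 0<P

  0≤X : 0ℚ ≤ X
  0≤X = 0≤ι a′ ⊗ 0≤ι b′

  cancel-P : ∀ {p q} → p * P ≤ q * P → p ≤ q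
  cancel-P = *-cancelʳ-≤-pos P {{positive 0<P}}

  ι-square : ∀ p m n → p * p * ι (m ℕ.* n) ≡ p * p * (ι m * ι n)
  ι-square p m n = cong (p * p *_) (ι-* m n)

  cosine-small : ι a ≤ r * r * ι b → ι k ≤ r * r * ι b → Approxᶜ cosine C′ 0ℚ (r + r)
  cosine-small a≤rrb k≤rrb = inj₁ (0-p≤0 (0≤r ⊕ 0≤r)) , ≤-trans (0≤r ⊕ 0≤r) (≤-reflexive (sym (+-identityˡ (r + r)))) , I′²≤
    where
    open ≤-Reasoning
    ρ′ : ℚ
    ρ′ = 0ℚ + (r + r)
    I′²≤ : ι (I′ ℕ.* I′) ≤ ρ′ * ρ′ * ι (a′ ℕ.* b′)
    I′²≤ = begin
      ι (I′ ℕ.* I′)                        ≡⟨ ι-* I′ I′ ⟩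
      ι I′ * ι I′                          ≤⟨ *-mono-≤-nonNeg (0≤ι I′) (ι-mono-≤ I′≤a′) (0≤ι I′) (ι-mono-≤ I′≤a′) ⟩
      ι a′ * ι a′                          ≤⟨ *-monoˡ-≤-nonNeg (ι a′) {{nonNegative (0≤ι a′)}}
                                                (cosine-small-bound (0≤ι b) ιa′≤a+k ιb≤b′+k a≤rrb k≤rrb) ⟩
      ι a′ * ((r + r) * (r + r) * ι b′)    ≡⟨ solve 3 (λ a′ b′ r → a′ :* ((r :+ r) :* (r :+ r) :* b′) :=
                                                (con 0ℚ :+ (r :+ r)) :* (con 0ℚ :+ (r :+ r)) :* (a′ :* b′)) refl (ι a′) (ι b′) r ⟩
      ρ′ * ρ′ * X                           ≡⟨ ι-square ρ′ a′ b′ ⟨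
      ρ′ * ρ′ * ι (a′ ℕ.* b′)               ∎

  cosine-upper-drift : ∀ {q} → 0ℚ ≤ q → ι k * ι k ≤ r * r * P → ι (I ℕ.* I) ≤ q * q * ι (a ℕ.* b) →
                       ι (I′ ℕ.* I′) ≤ (q + r) * (q + r) * ι (a′ ℕ.* b′)
  cosine-upper-drift {q} 0≤q k²≤ upper = begin
    ι (I′ ℕ.* I′)                          ≡⟨ ι-* I′ I′ ⟩
    ι I′ * ι I′                            ≤⟨ cancel-P (begin
      ι I′ * ι I′ * P                           ≤⟨ cosine-upper (0≤ι I′) (0≤ι a′) (0≤ι b) (ι-mono-≤ I′≤a′) (ι-mono-≤ I′≤b′)
                                                                ιI′+a≤I+a′+k ιI′+b≤I+b′+k ιI′≤I+k (ι-mono-≤ a≤b) ⟩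
      (ι I + ι k) * (ι I + ι k) * X             ≤⟨ *-monoʳ-≤-nonNeg X {{nonNegative 0≤X}}
                                                     (square-sum-≤ (ι I) (ι k) 0≤q 0≤r 0≤P
                                                        (subst₂ (λ u v → u ≤ q * q * v) (ι-* I I) (ι-* a b) upper) k²≤) ⟩
      (q + r) * (q + r) * P * X                 ≡⟨ solve 4 (λ q r P X → q :* r :* P :* X := q :* r :* X :* P) refl (q + r) (q + r) P X ⟩
      (q + r) * (q + r) * X * P                 ∎) ⟩
    (q + r) * (q + r) * X                   ≡⟨ ι-square (q + r) a′ b′ ⟨
    (q + r) * (q + r) * ι (a′ ℕ.* b′)       ∎
    where open ≤-Reasoning

  cosine-lower-drift : ∀ {q} → r < q → ι k * ι k ≤ r * r * P → q * q * ι (a ℕ.* b) ≤ ι (I ℕ.* I) →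
                       (q - r) * (q - r) * ι (a′ ℕ.* b′) ≤ ι (I′ ℕ.* I′)
  cosine-lower-drift {q} r<q k²≤ lower = begin
    (q - r) * (q - r) * ι (a′ ℕ.* b′)       ≡⟨ ι-square (q - r) a′ b′ ⟩
    (q - r) * (q - r) * X                   ≤⟨ cancel-P (begin
      (q - r) * (q - r) * X * P                 ≡⟨ solve 3 (λ d X P → d :* d :* X :* P := d :* d :* P :* X) refl (q - r) X P ⟩
      (q - r) * (q - r) * P * X                 ≤⟨ *-monoʳ-≤-nonNeg X {{nonNegative 0≤X}} (proj₂ I-k≥) ⟩
      (ι I - ι k) * (ι I - ι k) * X             ≤⟨ cosine-lower (0≤ι k) (0≤ι b′) ιI+a′≤a+I′+k ιI+b′≤b+I′+k ιI≤I′+k (proj₁ I-k≥)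
                                                                (ι-mono-≤ I≤a) (ι-mono-≤ a≤b) ⟩
      ι I′ * ι I′ * P                           ∎) ⟩
    ι I′ * ι I′                             ≡⟨ ι-* I′ I′ ⟨
    ι (I′ ℕ.* I′)                           ∎
    where
    open ≤-Reasoning
    I-k≥ : ι k ≤ ι I × (q - r) * (q - r) * P ≤ (ι I - ι k) * (ι I - ι k)
    I-k≥ = square-diff-≤ (ι k) 0≤r r<q (0≤ι I) 0≤P (subst₂ (λ u v → q * q * u ≤ v) (ι-* a b) (ι-* I I) lower) k²≤

  cosine-large : ∀ {s} → ι k ≤ r * r * ι b → r * r * ι b ≤ ι a → Approxᶜ cosine C s r → Approxᶜ cosine C′ s (r + r)
  cosine-large {s} k≤rrb rrb≤a (lower , 0≤s+r , upper) = lower′ , 0≤s+2r , upper′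
    where
    k²≤ : ι k * ι k ≤ r * r * P
    k²≤ = cosine-updates-bound (0≤ι k) (0≤ι b) k≤rrb rrb≤a
    s+r+r≡s+2r : s + r + r ≡ s + (r + r)
    s+r+r≡s+2r = +-assoc s r r
    0≤s+2r : 0ℚ ≤ s + (r + r)
    0≤s+2r = ≤-trans (0≤s+r ⊕ 0≤r) (≤-reflexive s+r+r≡s+2r)
    upper′ : ι (I′ ℕ.* I′) ≤ (s + (r + r)) * (s + (r + r)) * ι (a′ ℕ.* b′)
    upper′ = subst (λ q → ι (I′ ℕ.* I′) ≤ q * q * ι (a′ ℕ.* b′)) s+r+r≡s+2r (cosine-upper-drift 0≤s+r k²≤ upper)
    lower′ : (s - (r + r) ≤ 0ℚ) ⊎ ((s - (r + r)) * (s - (r + r)) * ι (a′ ℕ.* b′) ≤ ι (I′ ℕ.* I′))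
    lower′ with s - (r + r) ≤? 0ℚ
    ... | yes s-2r≤0 = inj₁ s-2r≤0
    ... | no s-2r≰0 = inj₂ (subst (λ q → q * q * ι (a′ ℕ.* b′) ≤ ι (I′ ℕ.* I′)) s-r-r≡s-2r (from lower))
      where
      s-r-r≡s-2r : s - r - r ≡ s - (r + r)
      s-r-r≡s-2r = solve 2 (λ s r → s :- r :- r := s :- (r :+ r)) refl s r
      r<s-r : r < s - r
      r<s-r = <-byGap (s - (r + r)) (solve 2 (λ s r → s :- r := r :+ (s :- (r :+ r))) refl s r) (≰⇒> s-2r≰0)
      from : (s - r ≤ 0ℚ) ⊎ ((s - r) * (s - r) * ι (a ℕ.* b) ≤ ι (I ℕ.* I)) →
             (s - r - r) * (s - r - r) * ι (a′ ℕ.* b′) ≤ ι (I′ ℕ.* I′)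
      from (inj₁ s-r≤0) = ⊥-elim (<-irrefl refl (≤-<-trans 0≤r (<-≤-trans r<s-r s-r≤0)))
      from (inj₂ lower) = cosine-lower-drift r<s-r k²≤ lower

  affordable : ∀ m {s} → (ι a ≤ (+ 1 / 4) * ρ * ρ * ι b → s ≡ 0ℚ) →
               (¬ (ι a ≤ (+ 1 / 4) * ρ * ρ * ι b) → Approxᶜ m C s (½ * ρ)) →
               ι k ≤ (+ 1 / 4) * ρ * ρ * ι b → Approxᶜ m C′ s ρ
  affordable m {s} small⇒s≡0 large⇒approx k≤cb =
    subst (Approxᶜ m C′ s) (solve 1 (λ ρ → con ½ :* ρ :+ con ½ :* ρ := ρ) refl ρ) (decide (ι a ≤? r * r * ι b))
    where
    c≡rr : (+ 1 / 4) * ρ * ρ ≡ r * r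
    c≡rr = solve 1 (λ ρ → con (+ 1 / 4) :* ρ :* ρ := con ½ :* ρ :* (con ½ :* ρ)) refl ρ
    below : ∀ {x} → x ≤ (+ 1 / 4) * ρ * ρ * ι b → x ≤ r * r * ι b
    below {x} = subst (λ c → x ≤ c * ι b) c≡rr
    decide : Dec (ι a ≤ r * r * ι b) → Approxᶜ m C′ s (r + r)
    decide (yes a≤rrb) =
      subst (λ s → Approxᶜ m C′ s (r + r)) (sym (small⇒s≡0 (subst (λ c → ι a ≤ c * ι b) (sym c≡rr) a≤rrb))) (small m)
      where
      small : ∀ m → Approxᶜ m C′ 0ℚ (r + r)
      small jaccard = jaccard-small a≤rrb (below k≤cb)
      small cosine  = cosine-small a≤rrb (below k≤cb)
      small dice    = dice-small a≤rrb (below k≤cb)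
    decide (no a≰rrb) = large m (large⇒approx (a≰rrb ∘ below))
      where
      rrb≤a : r * r * ι b ≤ ι a
      rrb≤a = <⇒≤ (≰⇒> a≰rrb)
      large : ∀ m → Approxᶜ m C s r → Approxᶜ m C′ s (r + r)
      large jaccard = jaccard-large {s} (below k≤cb)
      large cosine  = cosine-large {s} (below k≤cb) rrb≤a
      large dice    = dice-large {s} (below k≤cb) rrb≤a

claim1 : ∀ {V} (G : Graph V) (u v : Fin V) (ρ : ℚ) (m : Measure) (s : ℚ)
    → 0ℚ < ρ → ρ < 1ℚ
    → adj G u v ≡ true
    → nn G u ℕ.≤ nn G v
    → (ι (nn G u) ≤ ((+ 1 / 4) * ρ * ρ) * ι (nn G v) → s ≡ 0ℚ)
    → (¬ (ι (nn G u) ≤ ((+ 1 / 4) * ρ * ρ) * ι (nn G v)) → Approx m G u v s ((+ 1 / 2) * ρ))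
    → ((∀ (k : ℕ) (G' : Graph V)
          → ι k ≤ ((+ 1 / 4) * ρ * ρ) * ι (nn G v)
          → Updates u v G k G'
          → Approx m G' u v s ρ)
       × (((+ 1 / 4) * ρ * ρ) * ι (deg G u ⊔ deg G v) ≤ ((+ 1 / 4) * ρ * ρ) * ι (nn G v)))
claim1 G u v ρ m s 0<ρ ρ<1 uv∈E nᵤ≤nᵥ small⇒s≡0 large⇒approx = within-affordability , dmax≤nᵥ
  where
  u≢v : u ≢ v
  u≢v refl with trans (sym uv∈E) (irrefl G u)
  ... | ()
  within-affordability : ∀ k G′ → ι k ≤ (+ 1 / 4) * ρ * ρ * ι (nn G v) → Updates u v G k G′ → Approx m G′ u v s ρ
  within-affordability k G′ k≤ updates = subst id (sym (Approx≡Approxᶜ G′ u v m))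
    (Affordability.affordable 0<ρ ρ<1 nᵤ≤nᵥ (drift-of-updates u≢v updates) m small⇒s≡0
       (subst id (Approx≡Approxᶜ G u v m) ∘ large⇒approx) k≤)
  0≤¼ρρ : 0ℚ ≤ (+ 1 / 4) * ρ * ρ
  0≤¼ρρ = ≤ᵇ⇒≤ {0ℚ} {+ 1 / 4} _ ⊗ <⇒≤ 0<ρ ⊗ <⇒≤ 0<ρ
  dmax≤nᵥ : (+ 1 / 4) * ρ * ρ * ι (deg G u ⊔ deg G v) ≤ (+ 1 / 4) * ρ * ρ * ι (nn G v)
  dmax≤nᵥ = *-monoˡ-≤-nonNeg ((+ 1 / 4) * ρ * ρ) {{nonNegative 0≤¼ρρ}}
              (ι-mono-≤ (ℕₚ.⊔-lub (ℕₚ.≤-trans (deg≤nn G u) nᵤ≤nᵥ) (deg≤nn G v)))
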